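{- Fix $q,t\in\mathbb{K}$. For a graph $G$ let $\mathbf{L}[G]$ be the $\mathbb{K}$-vector space with basis the linear orders on $V(G)$. Then $\mathbf{L}$ is a $(q,t)$-Hopf monoid $\mathbf{L}_{q,t}$ with: product components $\mu_G^{S,T}:\mathbf{L}[G_S]\otimes\mathbf{L}[G_T]\to\mathbf{L}[G]$, $\ell_S\otimes\ell_T\mapsto\ell_S\cdot\ell_T$ (concatenation: all elements of $S$ before all elements of $T$, each in its own order); coproduct components $\Delta_G^{S,T}:\mathbf{L}[G]\to\mathbf{L}[G_S]\otimes\mathbf{L}[G_T]$, $\ell\mapsto q^{\mathrm{inv}_{S,T}(\ell,G)}\,t^{\mathrm{inv}_{S,T}(\ell,\overline{G})}\,\ell|_S\otimes\ell|_T$; and antipode $s_G(\ell)=(-1)^{n}q^{e(G)}t^{e(\overline{G})}\,\overline{\ell}$, where $n=|V(G)|$, $e(G)$ is the number of edges of $G$ and $\overline{\ell}$ is the reverse of $\ell$.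
   Context: All graphs are finite simple graphs over a field $\mathbb{K}$. A graphical species is a functor from finite graphs with graph isomorphisms to $\mathbb{K}$-vector spaces. For $S\subseteq V(G)$, $G_S$ is the induced subgraph; $\overline{G}$ is the complement graph; $e(G,S,T)$ is the number of edges of $G$ with one endpoint in $S$ and one in $T$. A decomposition $S|T\models V(G)$ is an ordered pair of disjoint (possibly empty) sets with union $V(G)$. The Cauchy product is $(\mathbf{g}\cdot\mathbf{h})[G]=\bigoplus_{S|T\models V(G)}\mathbf{g}[G_S]\otimes\mathbf{h}[G_T]$, and the braiding $\beta_{q,t}$ acts on the $(S,T)$ summand by $x\otimes y\mapsto q^{e(G,S,T)}t^{e(\overline{G},S,T)}y\otimes x$. A $(q,t)$-bimonoid is a graphical species $\mathbf{g}$ with associative unital product components $\mu_G^{S,T}:\mathbf{g}[G_S]\otimes\mathbf{g}[G_T]\to\mathbf{g}[G]$ and coassociative counital coproduct components $\Delta_G^{S,T}:\mathbf{g}[G]\to\mathbf{g}[G_S]\otimes\mathbf{g}[G_T]$ (natural in graph isomorphisms) satisfying the compatibility: for all $G$ and decompositions $S|T$, $S'|T'$ of $V(G)$, with $A=S\cap S'$, $B=S\cap T'$, $C=T\cap S'$, $D=T\cap T'$, one has $\Delta_G^{S',T'}\circ\mu_G^{S,T}=(\mu_{G_{S'}}^{A,C}\otimes\mu_{G_{T'}}^{B,D})\circ(\mathrm{id}\otimes\beta^{B,C}_{q,t}\otimes\mathrm{id})\circ(\Delta_{G_S}^{A,B}\otimes\Delta_{G_T}^{C,D})$, where $\beta^{B,C}_{q,t}(x\otimes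 y)=q^{e(G,B,C)}t^{e(\overline G,B,C)}y\otimes x$, together with the usual unit/counit compatibilities. A $(q,t)$-Hopf monoid is a $(q,t)$-bimonoid with an antipode $s$ (a morphism $s:\mathbf{g}\to\mathbf{g}$ that is the convolution inverse of the identity: for every nonempty $G$, $\sum_{S|T\models V(G)}\mu_G^{S,T}\circ(s_{G_S}\otimes\mathrm{id})\circ\Delta_G^{S,T}=0=\sum_{S|T\models V(G)}\mu_G^{S,T}\circ(\mathrm{id}\otimes s_{G_T})\circ\Delta_G^{S,T}$, and on $\emptyset$ the corresponding composites equal $\eta\circ\epsilon$). For a linear order $\ell$ on $V(G)$ and $S|T\models V(G)$, $\ell|_S$ is the restriction, and $\mathrm{inv}_{S,T}(\ell,G)=|\{st\in E(G): s\in S,\ t\in T,\ s>_\ell t\}|$. -}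

module Defs where

open import Level using (Level; _⊔_) renaming (suc to lsuc)
open import Data.Bool using (Bool; true; false; not; _∧_; _∨_; if_then_else_; T)
open import Data.Nat using (ℕ; zero; suc) renaming (_≡ᵇ_ to _==_; _+_ to _+ℕ_)
open import Data.List using (List; []; _∷_; _++_; map; concat; concatMap; filterᵇ; reverse; length; foldr)
open import Data.List.Relation.Unary.All using (All)
open import Data.List.Relation.Unary.Unique.Propositional using (Unique)
import Data.List.Relation.Unary.Unique.Propositional.Properties as UniqueP
open import Data.List.Relation.Binary.Permutation.Propositional using (_↭_)
open import Data.List.Membership.Propositional using (_∈_)
open import Data.Product using (Σ; ∃; _×_; _,_; proj₁; proj₂)
open import Data.Unit using (⊤)
open import Function using (_∘_; id; const)
open import Relation.Nullary using (¬_; Dec; yes; no)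
open import Relation.Nullary.Decidable using (⌊_⌋; T?)
open import Relation.Binary.PropositionalEquality using (_≡_; _≢_)
open import Relation.Binary.Definitions using (DecidableEquality)
open import Algebra.Bundles using (CommutativeRing)
import Data.List.Properties as ListP
import Data.Product.Properties as ProdP
import Data.Nat.Properties as NatP

record Field (c ℓ : Level) : Set (lsuc (c ⊔ ℓ)) where
  field
    commutativeRing : CommutativeRing c ℓ
  open CommutativeRing commutativeRing public
  field
    0≉1     : ¬ (0# ≈ 1#)
    inverse : ∀ x → ¬ (x ≈ 0#) → Σ Carrier λ y → x * y ≈ 1#

-- Vertices are labelled by natural numbers; the
-- vertex set is a duplicate-free list V, and adjacency is a symmetric,
-- irreflexive Boolean relation (only its values on V matter).

record Graph : Set where
  field
    V          : List ℕ
    V-unique   : Unique V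
    adj        : ℕ → ℕ → Bool
    adj-sym    : ∀ u v → adj u v ≡ adj v u
    adj-irrefl : ∀ v → adj v v ≡ false
open Graph public

-- A decomposition S|T ⊨ V(G) is given by a Boolean predicate χ:
-- S = {v ∈ V(G) | χ v = true}, T = {v ∈ V(G) | χ v = false}.
Decomp : Set
Decomp = ℕ → Bool

_∣_ : Graph → Decomp → Graph
G ∣ χ = record
  { V = filterᵇ χ (V G)
  ; V-unique = UniqueP.filter⁺ (T? ∘ χ) (V-unique G)
  ; adj = adj G
  ; adj-sym = adj-sym G
  ; adj-irrefl = adj-irrefl G }

_∣ᶜ_ : Graph → Decomp → Graph
G ∣ᶜ χ = G ∣ (not ∘ χ)

complement : Graph → Graph
complement G = record
  { V = V G
  ; V-unique = V-unique G
  ; adj = λ u v → not (adj G u v) ∧ not (u == v)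
  ; adj-sym = sym′
  ; adj-irrefl = irr }
  where
  open import Relation.Binary.PropositionalEquality using (refl; cong₂; cong)
  ==-sym : ∀ u v → (u == v) ≡ (v == u)
  ==-sym zero zero = refl
  ==-sym zero (suc v) = refl
  ==-sym (suc u) zero = refl
  ==-sym (suc u) (suc v) = ==-sym u v
  ==-refl : ∀ v → (v == v) ≡ true
  ==-refl zero = refl
  ==-refl (suc v) = ==-refl v
  sym′ : ∀ u v → (not (adj G u v) ∧ not (u == v)) ≡ (not (adj G v u) ∧ not (v == u))
  sym′ u v = cong₂ (λ a b → not a ∧ not b) (adj-sym G u v) (==-sym u v)
  irr : ∀ v → (not (adj G v v) ∧ not (v == v)) ≡ false
  irr v rewrite ==-refl v = ∧-false (not (adj G v v))
    where
    ∧-false : ∀ b → (b ∧ false) ≡ false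
    ∧-false true = refl
    ∧-false false = refl

crossEdges : Graph → List ℕ → List ℕ → ℕ
crossEdges G X Y = foldr (λ x n → length (filterᵇ (adj G x) Y) +ℕ n) 0 X

edgesOf : (ℕ → ℕ → Bool) → List ℕ → ℕ
edgesOf a []       = 0
edgesOf a (x ∷ xs) = length (filterᵇ (a x) xs) +ℕ edgesOf a xs

numEdges : Graph → ℕ
numEdges G = edgesOf (adj G) (V G)

-- inv_{S,T}(ℓ,G) = |{ st ∈ E(G) : s ∈ S, t ∈ T, s >_ℓ t }|, where the
-- linear order ℓ is given as the list of vertices from smallest to largest.
invST : Graph → Decomp → List ℕ → ℕ
invST G χ []       = 0
invST G χ (x ∷ xs) =
  (if χ x then 0 else length (filterᵇ (λ y → χ y ∧ adj G x y) xs)) +ℕ invST G χ xs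

-- Enumeration of all decompositions of a vertex list (one predicate per
-- subset S of the list; distinct for duplicate-free lists).
decomps : List ℕ → List Decomp
decomps []       = const false ∷ []
decomps (x ∷ xs) = concatMap
  (λ χ → (λ v → if v == x then true else χ v)
       ∷ (λ v → if v == x then false else χ v) ∷ []) (decomps xs)

IsIso : Graph → Graph → (ℕ → ℕ) → Set
IsIso G H σ = (map σ (V G) ↭ V H)
            × (∀ u v → u ∈ V G → v ∈ V G → adj H (σ u) (σ v) ≡ adj G u v)

-- Free K-vector spaces and the (q,t)-Hopf monoid axioms for species
-- whose components are free on a basis (a linear map is determined by its
-- values on a basis, so all axioms are stated on basis elements).

module OverField {c ℓ : Level} (F : Field c ℓ) where
  open Field F

  pow : Carrier → ℕ → Carrier
  pow x zero    = 1#
  pow x (suc n) = x * pow x n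

  -- elements of the free vector space on B, as formal linear combinations
  FM : Set → Set c
  FM B = List (Carrier × B)

  coeff : {B : Set} → DecidableEquality B → B → FM B → Carrier
  coeff _≟_ b = foldr (λ p acc → if ⌊ b ≟ proj₂ p ⌋ then proj₁ p + acc else acc) 0#

  VecEq : {B : Set} → DecidableEquality B → FM B → FM B → Set ℓ
  VecEq _≟_ v w = ∀ b → coeff _≟_ b v ≈ coeff _≟_ b w

  basisVec : {B : Set} → B → FM B
  basisVec b = (1# , b) ∷ []

  _·ᶠ_ : {B : Set} → Carrier → FM B → FM B
  k ·ᶠ v = map (λ p → (k * proj₁ p , proj₂ p)) v

  bind : {A B : Set} → FM A → (A → FM B) → FM B
  bind v f = concatMap (λ p → proj₁ p ·ᶠ f (proj₂ p)) v

  mapᶠ : {A B : Set} → (A → B) → FM A → FM B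
  mapᶠ f v = map (λ p → (proj₁ p , f (proj₂ p))) v

  _⊗ᶠ_ : {A B : Set} → FM A → FM B → FM (A × B)
  v ⊗ᶠ w = bind v (λ a → bind w (λ b → basisVec (a , b)))

  linF : {B : Set} → (B → Carrier) → FM B → Carrier
  linF f v = foldr (λ p acc → proj₁ p * f (proj₂ p) + acc) 0# v

  sumᶠ : {B : Set} → List (FM B) → FM B
  sumᶠ = concat

  zeroᶠ : {B : Set} → FM B
  zeroᶠ = []

  -- A graphical species whose component g[G] is the free vector space on
  -- the elements b : B with  basis G b ; isomorphisms act via  act σ .
  -- μ G χ x y : product component μ_G^{S,T}(x ⊗ y)  (x ∈ g[G_S], y ∈ g[G_T])
  -- Δ G χ x   : coproduct component Δ_G^{S,T}(x)
  -- s G x     : antipode s_G(x)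
  -- η         : the unit η(1) ∈ g[∅];  ε : counit on basis of g[∅].
  record IsQTHopfMonoid (q t : Carrier) (B : Set) (_≟_ : DecidableEquality B)
         (basis : Graph → B → Set) (act : (ℕ → ℕ) → B → B)
         (μ : Graph → Decomp → B → B → FM B)
         (Δ : Graph → Decomp → B → FM (B × B))
         (s : Graph → B → FM B)
         (η : FM B) (ε : B → Carrier) : Set (c ⊔ ℓ) where
    _≟₂_ : DecidableEquality (B × B)
    _≟₂_ = ProdP.≡-dec _≟_ _≟_
    _≟₃_ : DecidableEquality (B × (B × B))
    _≟₃_ = ProdP.≡-dec _≟_ _≟₂_
    _≈₁_ : FM B → FM B → Set ℓ
    _≈₁_ = VecEq _≟_
    _≈₂_ : FM (B × B) → FM (B × B) → Set ℓ
    _≈₂_ = VecEq _≟₂_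
    _≈₃_ : FM (B × (B × B)) → FM (B × (B × B)) → Set ℓ
    _≈₃_ = VecEq _≟₃_
    braid : Graph → List ℕ → List ℕ → Carrier
    braid G X Y = pow q (crossEdges G X Y) * pow t (crossEdges (complement G) X Y)
    field
      act-basis : ∀ G H σ → IsIso G H σ → ∀ x → basis G x → basis H (act σ x)
      act-id    : ∀ G x → basis G x → act id x ≡ x
      act-∘     : ∀ G σ τ x → basis G x → act (τ ∘ σ) x ≡ act τ (act σ x)
      μ-basis : ∀ G χ x y → basis (G ∣ χ) x → basis (G ∣ᶜ χ) y →
                All (λ p → basis G (proj₂ p)) (μ G χ x y)
      Δ-basis : ∀ G χ x → basis G x →
                All (λ p → basis (G ∣ χ) (proj₁ (proj₂ p)) × basis (G ∣ᶜ χ) (proj₂ (proj₂ p)))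
                    (Δ G χ x)
      s-basis : ∀ G x → basis G x → All (λ p → basis G (proj₂ p)) (s G x)
      η-basis : ∀ G → V G ≡ [] → All (λ p → basis G (proj₂ p)) η
      μ-nat : ∀ G H σ → IsIso G H σ → ∀ χ χ′ → (∀ v → v ∈ V G → χ′ (σ v) ≡ χ v) →
              ∀ x y → basis (G ∣ χ) x → basis (G ∣ᶜ χ) y →
              μ H χ′ (act σ x) (act σ y) ≈₁ mapᶠ (act σ) (μ G χ x y)
      Δ-nat : ∀ G H σ → IsIso G H σ → ∀ χ χ′ → (∀ v → v ∈ V G → χ′ (σ v) ≡ χ v) →
              ∀ x → basis G x →
              Δ H χ′ (act σ x) ≈₂ mapᶠ (λ p → (act σ (proj₁ p) , act σ (proj₂ p))) (Δ G χ x)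
      s-nat : ∀ G H σ → IsIso G H σ → ∀ x → basis G x →
              s H (act σ x) ≈₁ mapᶠ (act σ) (s G x)
      η-nat : ∀ G H σ → IsIso G H σ → V G ≡ [] → mapᶠ (act σ) η ≈₁ η
      ε-nat : ∀ G H σ → IsIso G H σ → V G ≡ [] → ∀ x → basis G x → ε (act σ x) ≈ ε x
      -- associativity: decomposition R|S|T with R = χ, S = ¬χ ∧ ρ, T = ¬χ ∧ ¬ρ
      μ-assoc : ∀ G χ ρ x y z → basis (G ∣ χ) x → basis ((G ∣ᶜ χ) ∣ ρ) y →
                basis ((G ∣ᶜ χ) ∣ᶜ ρ) z →
                bind (μ (G ∣ (λ v → χ v ∨ ρ v)) χ x y) (λ w → μ G (λ v → χ v ∨ ρ v) w z)
                  ≈₁ bind (μ (G ∣ᶜ χ) ρ y z) (λ w → μ G χ x w)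
      μ-unitˡ : ∀ G x → basis G x → bind η (λ e → μ G (const false) e x) ≈₁ basisVec x
      μ-unitʳ : ∀ G x → basis G x → bind η (λ e → μ G (const true) x e) ≈₁ basisVec x
      Δ-coassoc : ∀ G χ ρ x → basis G x →
                bind (Δ G (λ v → χ v ∨ ρ v) x)
                     (λ p → mapᶠ (λ ab → (proj₁ ab , (proj₂ ab , proj₂ p))) (Δ (G ∣ (λ v → χ v ∨ ρ v)) χ (proj₁ p)))
                  ≈₃ bind (Δ G χ x)
                     (λ p → mapᶠ (λ bc → (proj₁ p , bc)) (Δ (G ∣ᶜ χ) ρ (proj₂ p)))
      Δ-counitˡ : ∀ G x → basis G x →
                  bind (Δ G (const false) x) (λ p → ε (proj₁ p) ·ᶠ basisVec (proj₂ p)) ≈₁ basisVec x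
      Δ-counitʳ : ∀ G x → basis G x →
                  bind (Δ G (const true) x) (λ p → ε (proj₂ p) ·ᶠ basisVec (proj₁ p)) ≈₁ basisVec x
      ε-η : linF ε η ≈ 1#
      Δ-η : ∀ G χ → V G ≡ [] → bind η (Δ G χ) ≈₂ (η ⊗ᶠ η)
      ε-μ : ∀ G χ → V G ≡ [] → ∀ x y → basis G x → basis G y →
            linF ε (μ G χ x y) ≈ ε x * ε y
      compat : ∀ G χ χ′ x y → basis (G ∣ χ) x → basis (G ∣ᶜ χ) y →
               bind (μ G χ x y) (Δ G χ′)
                 ≈₂ (braid G (V ((G ∣ χ) ∣ᶜ χ′)) (V ((G ∣ᶜ χ) ∣ χ′))
                     ·ᶠ bind (Δ (G ∣ χ) χ′ x) (λ ab → bind (Δ (G ∣ᶜ χ) χ′ y) (λ cd →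
                          μ (G ∣ χ′) χ (proj₁ ab) (proj₁ cd)
                            ⊗ᶠ μ (G ∣ᶜ χ′) χ (proj₂ ab) (proj₂ cd))))
      antipodeˡ : ∀ G x → basis G x → V G ≢ [] →
                  sumᶠ (map (λ χ → bind (Δ G χ x) (λ p →
                          bind (s (G ∣ χ) (proj₁ p)) (λ a → μ G χ a (proj₂ p)))) (decomps (V G)))
                    ≈₁ zeroᶠ
      antipodeʳ : ∀ G x → basis G x → V G ≢ [] →
                  sumᶠ (map (λ χ → bind (Δ G χ x) (λ p →
                          bind (s (G ∣ᶜ χ) (proj₂ p)) (λ b → μ G χ (proj₁ p) b))) (decomps (V G)))
                    ≈₁ zeroᶠ
      antipode∅ˡ : ∀ G x → basis G x → V G ≡ [] →
                  sumᶠ (map (λ χ → bind (Δ G χ x) (λ p →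
                          bind (s (G ∣ χ) (proj₁ p)) (λ a → μ G χ a (proj₂ p)))) (decomps (V G)))
                    ≈₁ (ε x ·ᶠ η)
      antipode∅ʳ : ∀ G x → basis G x → V G ≡ [] →
                  sumᶠ (map (λ χ → bind (Δ G χ x) (λ p →
                          bind (s (G ∣ᶜ χ) (proj₂ p)) (λ b → μ G χ (proj₁ p) b))) (decomps (V G)))
                    ≈₁ (ε x ·ᶠ η)

  -- The species L of linear orders, with the structure maps of L_{q,t}.
  -- A linear order on V(G) is the list of its elements in increasing
  -- order, i.e. a rearrangement of V(G).

  LinOrd : Graph → List ℕ → Set
  LinOrd G ℓ′ = ℓ′ ↭ V G

  actL : (ℕ → ℕ) → List ℕ → List ℕ
  actL σ = map σ

  μL : Graph → Decomp → List ℕ → List ℕ → FM (List ℕ)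
  μL G χ ℓS ℓT = basisVec (ℓS ++ ℓT)

  ΔL : Carrier → Carrier → Graph → Decomp → List ℕ → FM (List ℕ × List ℕ)
  ΔL q t G χ ℓ′ =
    (pow q (invST G χ ℓ′) * pow t (invST (complement G) χ ℓ′) ,
     (filterᵇ χ ℓ′ , filterᵇ (not ∘ χ) ℓ′)) ∷ []

  sL : Carrier → Carrier → Graph → List ℕ → FM (List ℕ)
  sL q t G ℓ′ =
    (pow (- 1#) (length (V G)) * (pow q (numEdges G) * pow t (numEdges (complement G))) ,
     reverse ℓ′) ∷ []

  ηL : FM (List ℕ)
  ηL = basisVec []

  εL : List ℕ → Carrier
  εL _ = 1#

  _≟L_ : DecidableEquality (List ℕ)
  _≟L_ = ListP.≡-dec NatP._≟_

-- All structure maps send a linear order to a single scaled linear order, so each axiom is an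
-- equality of words together with an equality of scalars q^a t^b, i.e. of edge counts in G and in
-- its complement.
-- Coassociativity: for a split R|S|T, the inversions of (R∪S, T) plus those of (R, S) within R∪S
-- equal those of (R, S∪T) plus those of (S, T) within S∪T.
-- Compatibility: the S′|T′-inversions of ℓ_S·ℓ_T are those within each factor plus the edges
-- between S∩T′ and T∩S′, which is the braiding factor.
-- Antipode: moving the first letter a of ℓ (the last one, for the right antipode) to the other
-- side of a decomposition keeps the resulting word, flips the sign, and trades the edges between a
-- and the rest of the antipode side for as many inversions; so decompositions cancel in pairs.

module Submission where

open import Defs
open import Data.List using (List)
open import Data.Nat using (ℕ)

open import Data.Bool using (Bool; true; false; not; _∧_; _∨_; if_then_else_; T)
open import Data.Empty using (⊥-elim)
open import Data.List
  using ([]; _∷_; _++_; [_]; _∷ʳ_; map; filterᵇ; reverse; length; foldr; concat; concatMap)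
import Data.List.Properties as List
open import Data.List.Membership.Propositional using (_∈_)
open import Data.List.Membership.Propositional.Properties using (∈-map⁺; ∈-++⁺ʳ)
open import Data.List.Relation.Binary.Permutation.Propositional
  using (_↭_; prep; ↭-refl; ↭-trans; ↭-sym; ↭-reflexive; ↭⇒↭ₛ)
import Data.List.Relation.Binary.Permutation.Propositional as Perm
import Data.List.Relation.Binary.Permutation.Propositional.Properties as ↭
import Data.List.Relation.Binary.Permutation.Setoid.Properties as ↭ₛ
open import Data.List.Relation.Binary.Subset.Propositional using (_⊆_)
open import Data.List.Relation.Unary.All as All using (All; []; _∷_)
import Data.List.Relation.Unary.AllPairs as AllPairs
open import Data.List.Relation.Unary.Any using (here; there)
open import Data.List.Relation.Unary.Unique.Propositional using (Unique; _∷_)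
open import Data.List.Reverse using (reverseView; []; _∶_∶ʳ_)
open import Data.Nat using (zero; suc; _+_; _≡ᵇ_)
import Data.Nat.Properties as ℕ
open import Data.Nat.Tactic.RingSolver using (solve-∀)
open import Data.Product using (_×_; _,_; proj₁; proj₂)
import Data.Product.Properties as ×
open import Function using (_∘_; const)
open import Relation.Binary.Definitions using (DecidableEquality)
open import Relation.Binary.PropositionalEquality
  using (_≡_; _≢_; refl; sym; trans; cong; cong₂; subst; module ≡-Reasoning)
import Relation.Binary.PropositionalEquality as ≡
open import Relation.Nullary using (yes; no)
open import Relation.Nullary.Decidable using (T?; ⌊_⌋)

import Algebra.Properties.CommutativeSemigroup ℕ.+-commutativeSemigroup as +-CS

count : ∀ {a} {A : Set a} → (A → Bool) → List A → ℕ
count p xs = length (filterᵇ p xs)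

module _ {a} {A : Set a} where

  filterᵇ-cong : ∀ {p p′ : A → Bool} {xs} → All (λ x → p x ≡ p′ x) xs →
                 filterᵇ p xs ≡ filterᵇ p′ xs
  filterᵇ-cong [] = refl
  filterᵇ-cong {p} {p′} {x ∷ xs} (px≡p′x ∷ eqs) with p x | p′ x
  ... | true  | true  = cong (x ∷_) (filterᵇ-cong eqs)
  ... | false | false = filterᵇ-cong eqs
  ... | true  | false with () ← px≡p′x
  ... | false | true  with () ← px≡p′x

  filterᵇ-++ : ∀ (p : A → Bool) xs ys → filterᵇ p (xs ++ ys) ≡ filterᵇ p xs ++ filterᵇ p ys
  filterᵇ-++ p = List.filter-++ (T? ∘ p)

  filterᵇ-filterᵇ : ∀ (p p′ : A → Bool) xs →
                    filterᵇ p (filterᵇ p′ xs) ≡ filterᵇ (λ x → p′ x ∧ p x) xs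
  filterᵇ-filterᵇ p p′ [] = refl
  filterᵇ-filterᵇ p p′ (x ∷ xs) with p′ x
  ... | false = filterᵇ-filterᵇ p p′ xs
  ... | true with p x
  ...   | true  = cong (x ∷_) (filterᵇ-filterᵇ p p′ xs)
  ...   | false = filterᵇ-filterᵇ p p′ xs

  filterᵇ-filterᵇ-≗ : ∀ (p p′ r : A → Bool) → (∀ x → p′ x ∧ p x ≡ r x) →
                      ∀ xs → filterᵇ p (filterᵇ p′ xs) ≡ filterᵇ r xs
  filterᵇ-filterᵇ-≗ p p′ r eq xs =
    trans (filterᵇ-filterᵇ p p′ xs) (filterᵇ-cong (All.universal eq xs))

  filterᵇ-map : ∀ {b} {B : Set b} (p : A → Bool) (f : B → A) xs →
                filterᵇ p (map f xs) ≡ map f (filterᵇ (p ∘ f) xs)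
  filterᵇ-map p f [] = refl
  filterᵇ-map p f (x ∷ xs) with p (f x)
  ... | true  = cong (f x ∷_) (filterᵇ-map p f xs)
  ... | false = filterᵇ-map p f xs

  filterᵇ-↭ : ∀ (p : A → Bool) {xs ys} → xs ↭ ys → filterᵇ p xs ↭ filterᵇ p ys
  filterᵇ-↭ p = ↭.filter-↭ (T? ∘ p)

  filterᵇ-accept : ∀ (p : A → Bool) {x} xs → p x ≡ true → filterᵇ p (x ∷ xs) ≡ x ∷ filterᵇ p xs
  filterᵇ-accept p xs px rewrite px = refl

  filterᵇ-reject : ∀ (p : A → Bool) {x} xs → p x ≡ false → filterᵇ p (x ∷ xs) ≡ filterᵇ p xs
  filterᵇ-reject p xs px rewrite px = refl

  filterᵇ-true : ∀ (xs : List A) → filterᵇ (λ _ → true) xs ≡ xs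
  filterᵇ-true [] = refl
  filterᵇ-true (x ∷ xs) = cong (x ∷_) (filterᵇ-true xs)

  filterᵇ-partition : ∀ (p : A → Bool) xs → filterᵇ p xs ++ filterᵇ (not ∘ p) xs ↭ xs
  filterᵇ-partition p [] = ↭-refl
  filterᵇ-partition p (x ∷ xs) with p x
  ... | true  = prep x (filterᵇ-partition p xs)
  ... | false = ↭-trans (↭.shift x (filterᵇ p xs) (filterᵇ (not ∘ p) xs)) (prep x (filterᵇ-partition p xs))

  count-cong : ∀ {p p′ : A → Bool} {xs} → All (λ x → p x ≡ p′ x) xs → count p xs ≡ count p′ xs
  count-cong eqs = cong length (filterᵇ-cong eqs)

  count-↭ : ∀ (p : A → Bool) {xs ys} → xs ↭ ys → count p xs ≡ count p ys
  count-↭ p xs↭ys = ↭.↭-length (filterᵇ-↭ p xs↭ys)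

  count-++ : ∀ (p : A → Bool) xs ys → count p (xs ++ ys) ≡ count p xs + count p ys
  count-++ p xs ys = trans (cong length (filterᵇ-++ p xs ys)) (List.length-++ (filterᵇ p xs))

  count-filterᵇ : ∀ (p p′ : A → Bool) xs → count p (filterᵇ p′ xs) ≡ count (λ x → p′ x ∧ p x) xs
  count-filterᵇ p p′ xs = cong length (filterᵇ-filterᵇ p p′ xs)

  count-filterᵇ-weaker : ∀ (p p′ : A → Bool) → (∀ x → p x ≡ true → p′ x ≡ true) →
                         ∀ xs → count p (filterᵇ p′ xs) ≡ count p xs
  count-filterᵇ-weaker p p′ p⇒p′ [] = refl
  count-filterᵇ-weaker p p′ p⇒p′ (x ∷ xs) with p x in px | p′ x in p′x
  ... | true  | true  rewrite px = cong suc (count-filterᵇ-weaker p p′ p⇒p′ xs)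
  ... | true  | false with () ← trans (sym (p⇒p′ x px)) p′x
  ... | false | true  rewrite px = count-filterᵇ-weaker p p′ p⇒p′ xs
  ... | false | false = count-filterᵇ-weaker p p′ p⇒p′ xs

  count-∨-∧ : ∀ (p p′ r : A → Bool) xs →
    count (λ x → (p x ∨ p′ x) ∧ r x) xs ≡
    count (λ x → p x ∧ r x) xs + count (λ x → p′ x ∧ r x) (filterᵇ (not ∘ p) xs)
  count-∨-∧ p p′ r [] = refl
  count-∨-∧ p p′ r (x ∷ xs) with p x | p′ x in p′x | r x in rx
  ... | true  | _     | true  = cong suc (count-∨-∧ p p′ r xs)
  ... | true  | _     | false = count-∨-∧ p p′ r xs
  ... | false | true  | true  rewrite p′x | rx =
    trans (cong suc (count-∨-∧ p p′ r xs)) (sym (ℕ.+-suc _ _))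
  ... | false | true  | false rewrite p′x | rx = count-∨-∧ p p′ r xs
  ... | false | false | _     rewrite p′x = count-∨-∧ p p′ r xs

  count-map : ∀ {b} {B : Set b} (p : A → Bool) (f : B → A) xs → count p (map f xs) ≡ count (p ∘ f) xs
  count-map p f xs = trans (cong length (filterᵇ-map p f xs)) (List.length-map f (filterᵇ (p ∘ f) xs))

Unique-resp-↭ : ∀ {a} {A : Set a} {xs ys : List A} → xs ↭ ys → Unique xs → Unique ys
Unique-resp-↭ {A = A} xs↭ys = ↭ₛ.Unique-resp-↭ (≡.setoid A) (↭⇒↭ₛ xs↭ys)

injectiveOn-map-unique : ∀ {a b} {A : Set a} {B : Set b} (σ : A → B) {xs u v} → Unique (map σ xs) →
                         u ∈ xs → v ∈ xs → σ u ≡ σ v → u ≡ v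
injectiveOn-map-unique σ _ (here refl) (here refl) _ = refl
injectiveOn-map-unique σ (σx∉ ∷ _) (here refl) (there v∈) σx≡σv =
  ⊥-elim (All.lookup σx∉ (∈-map⁺ σ v∈) σx≡σv)
injectiveOn-map-unique σ (σx∉ ∷ _) (there u∈) (here refl) σu≡σx =
  ⊥-elim (All.lookup σx∉ (∈-map⁺ σ u∈) (sym σu≡σx))
injectiveOn-map-unique σ (_ ∷ unique) (there u∈) (there v∈) σu≡σv =
  injectiveOn-map-unique σ unique u∈ v∈ σu≡σv

≡ᵇ-refl : ∀ n → (n ≡ᵇ n) ≡ true
≡ᵇ-refl zero    = refl
≡ᵇ-refl (suc n) = ≡ᵇ-refl n

≢⇒≡ᵇ-false : ∀ {m n} → m ≢ n → (m ≡ᵇ n) ≡ false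
≢⇒≡ᵇ-false {m} {n} m≢n with m ≡ᵇ n in eq
... | true  = ⊥-elim (m≢n (ℕ.≡ᵇ⇒≡ m n (subst T (sym eq) _)))
... | false = refl

complement-iso : ∀ G H σ → IsIso G H σ → IsIso (complement G) (complement H) σ
complement-iso G H σ (σV↭V , adj-pres) = σV↭V , λ u v u∈ v∈ →
  cong₂ (λ e d → not e ∧ not d) (adj-pres u v u∈ v∈) (≡ᵇ-pres u v u∈ v∈)
  where
  ≡ᵇ-pres : ∀ u v → u ∈ V G → v ∈ V G → (σ u ≡ᵇ σ v) ≡ (u ≡ᵇ v)
  ≡ᵇ-pres u v u∈ v∈ with u ℕ.≟ v
  ... | yes refl = trans (≡ᵇ-refl (σ u)) (sym (≡ᵇ-refl u))
  ... | no u≢v   = trans (≢⇒≡ᵇ-false (u≢v ∘ injective)) (sym (≢⇒≡ᵇ-false u≢v))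
    where
    injective : σ u ≡ σ v → u ≡ v
    injective = injectiveOn-map-unique σ (Unique-resp-↭ (↭-sym σV↭V) (V-unique H)) u∈ v∈

invST-adj : ∀ {G H} → adj G ≡ adj H → ∀ χ ℓ → invST G χ ℓ ≡ invST H χ ℓ
invST-adj eq χ [] = refl
invST-adj eq χ (x ∷ ℓ) =
  cong₂ _+_ (cong (λ α → if χ x then 0 else count (λ y → χ y ∧ α x y) ℓ) eq) (invST-adj eq χ ℓ)

invST-cong : ∀ G {χ χ′ ℓ} → All (λ v → χ v ≡ χ′ v) ℓ → invST G χ ℓ ≡ invST G χ′ ℓ
invST-cong G [] = refl
invST-cong G {ℓ = x ∷ ℓ} (eq ∷ eqs) =
  cong₂ _+_ (cong₂ (λ b n → if b then 0 else n) eq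
                   (count-cong (All.map (λ {y} e → cong (_∧ adj G x y) e) eqs)))
            (invST-cong G eqs)

invST-const-false : ∀ G ℓ → invST G (const false) ℓ ≡ 0
invST-const-false G [] = refl
invST-const-false G (x ∷ ℓ) = cong₂ _+_ (count-false ℓ) (invST-const-false G ℓ)
  where
  count-false : ∀ xs → count (λ _ → false) xs ≡ 0
  count-false [] = refl
  count-false (_ ∷ xs) = count-false xs

invST-const-true : ∀ G ℓ → invST G (const true) ℓ ≡ 0
invST-const-true G [] = refl
invST-const-true G (x ∷ ℓ) = invST-const-true G ℓ

invST-map : ∀ G H σ → IsIso G H σ → ∀ {χ χ′} → (∀ v → v ∈ V G → χ′ (σ v) ≡ χ v) →
            ∀ {ℓ} → ℓ ⊆ V G → invST H χ′ (map σ ℓ) ≡ invST G χ ℓ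
invST-map G H σ iso χ-pres {[]} ℓ⊆V = refl
invST-map G H σ iso {χ} {χ′} χ-pres {x ∷ ℓ} ℓ⊆V =
  cong₂ _+_ (cong₂ (λ b n → if b then 0 else n) (χ-pres x (ℓ⊆V (here refl))) counts)
            (invST-map G H σ iso χ-pres (ℓ⊆V ∘ there))
  where
  counts : count (λ y → χ′ y ∧ adj H (σ x) y) (map σ ℓ) ≡ count (λ y → χ y ∧ adj G x y) ℓ
  counts = trans (count-map _ σ ℓ) (count-cong (All.tabulate λ {y} y∈ →
    cong₂ _∧_ (χ-pres y (ℓ⊆V (there y∈))) (proj₂ iso x y (ℓ⊆V (here refl)) (ℓ⊆V (there y∈)))))

edgesOf-map : ∀ G H σ → IsIso G H σ → ∀ {ℓ} → ℓ ⊆ V G →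
              edgesOf (adj H) (map σ ℓ) ≡ edgesOf (adj G) ℓ
edgesOf-map G H σ iso {[]} ℓ⊆V = refl
edgesOf-map G H σ iso {x ∷ ℓ} ℓ⊆V =
  cong₂ _+_ (trans (count-map (adj H (σ x)) σ ℓ) (count-cong (All.tabulate λ {y} y∈ →
              proj₂ iso x y (ℓ⊆V (here refl)) (ℓ⊆V (there y∈)))))
            (edgesOf-map G H σ iso (ℓ⊆V ∘ there))

edgesOf-swap : ∀ G x y xs ys →
  count (adj G x) xs + (count (adj G y) xs + edgesOf (adj G) xs) ≡
  count (adj G y) ys + (count (adj G x) ys + edgesOf (adj G) ys) →
  edgesOf (adj G) (x ∷ y ∷ xs) ≡ edgesOf (adj G) (y ∷ x ∷ ys)
edgesOf-swap G x y xs ys eq with adj G x y | adj G y x | adj-sym G x y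
... | true  | true  | _ = cong suc eq
... | false | false | _ = eq

edgesOf-↭ : ∀ G {xs ys} → xs ↭ ys → edgesOf (adj G) xs ≡ edgesOf (adj G) ys
edgesOf-↭ G Perm.refl = refl
edgesOf-↭ G (Perm.prep x p) = cong₂ _+_ (count-↭ (adj G x) p) (edgesOf-↭ G p)
edgesOf-↭ G {_ ∷ _ ∷ xs} (Perm.swap x y p) = edgesOf-swap G x y xs _
  (trans (+-CS.x∙yz≈y∙xz (count (adj G x) xs) (count (adj G y) xs) (edgesOf (adj G) xs))
  (cong₂ _+_ (count-↭ (adj G y) p) (cong₂ _+_ (count-↭ (adj G x) p) (edgesOf-↭ G p))))
edgesOf-↭ G (Perm.trans p q) = trans (edgesOf-↭ G p) (edgesOf-↭ G q)

numEdges-iso : ∀ G H σ → IsIso G H σ → numEdges H ≡ numEdges G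
numEdges-iso G H σ iso@(σV↭V , _) = trans (edgesOf-↭ H (↭-sym σV↭V)) (edgesOf-map G H σ iso (λ v∈ → v∈))

crossEdges-↭ˡ : ∀ G {X X′} Y → X ↭ X′ → crossEdges G X Y ≡ crossEdges G X′ Y
crossEdges-↭ˡ G Y Perm.refl = refl
crossEdges-↭ˡ G Y (Perm.prep x p) = cong (count (adj G x) Y +_) (crossEdges-↭ˡ G Y p)
crossEdges-↭ˡ G {x ∷ y ∷ X} Y (Perm.swap _ _ p) =
  trans (+-CS.x∙yz≈y∙xz (count (adj G x) Y) (count (adj G y) Y) (crossEdges G X Y))
        (cong (λ n → count (adj G y) Y + (count (adj G x) Y + n)) (crossEdges-↭ˡ G Y p))
crossEdges-↭ˡ G Y (Perm.trans p q) = trans (crossEdges-↭ˡ G Y p) (crossEdges-↭ˡ G Y q)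

crossEdges-↭ʳ : ∀ G X {Y Y′} → Y ↭ Y′ → crossEdges G X Y ≡ crossEdges G X Y′
crossEdges-↭ʳ G []      p = refl
crossEdges-↭ʳ G (x ∷ X) p = cong₂ _+_ (count-↭ (adj G x) p) (crossEdges-↭ʳ G X p)

crossEdges-[]ʳ : ∀ G X → crossEdges G X [] ≡ 0
crossEdges-[]ʳ G []      = refl
crossEdges-[]ʳ G (x ∷ X) = crossEdges-[]ʳ G X

crossEdges-singletonʳ : ∀ G b X → crossEdges G X [ b ] ≡ count (adj G b) X
crossEdges-singletonʳ G b [] = refl
crossEdges-singletonʳ G b (x ∷ X) rewrite adj-sym G x b with adj G b x
... | true  = cong suc (crossEdges-singletonʳ G b X)
... | false = crossEdges-singletonʳ G b X

invST-++ : ∀ G χ xs ys →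
  invST G χ (xs ++ ys) ≡ crossEdges G (filterᵇ (not ∘ χ) xs) (filterᵇ χ ys) + (invST G χ xs + invST G χ ys)
invST-++ G χ [] ys = refl
invST-++ G χ (x ∷ xs) ys with χ x
... | true  = invST-++ G χ xs ys
... | false = begin
  nbrs (xs ++ ys) + invST G χ (xs ++ ys)
    ≡⟨ cong₂ _+_ (count-++ _ xs ys) (invST-++ G χ xs ys) ⟩
  (nbrs xs + nbrs ys) + (K + (I + J))
    ≡⟨ cong (λ n → (nbrs xs + n) + (K + (I + J))) (count-filterᵇ (adj G x) χ ys) ⟨
  (nbrs xs + count (adj G x) Fs) + (K + (I + J))
    ≡⟨ regroup (nbrs xs) (count (adj G x) Fs) K I J ⟩
  (count (adj G x) Fs + K) + ((nbrs xs + I) + J) ∎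
  where
  open ≡-Reasoning
  nbrs : List ℕ → ℕ
  nbrs = count (λ y → χ y ∧ adj G x y)
  Fn Fs : List ℕ
  Fn = filterᵇ (not ∘ χ) xs
  Fs = filterᵇ χ ys
  I J K : ℕ
  I = invST G χ xs
  J = invST G χ ys
  K = crossEdges G Fn Fs
  regroup : ∀ a b c i j → (a + b) + (c + (i + j)) ≡ (b + c) + ((a + i) + j)
  regroup = solve-∀

invST-coassoc : ∀ G χ ρ ℓ →
  invST G (λ v → χ v ∨ ρ v) ℓ + invST G χ (filterᵇ (λ v → χ v ∨ ρ v) ℓ) ≡
  invST G χ ℓ + invST G ρ (filterᵇ (not ∘ χ) ℓ)
invST-coassoc G χ ρ [] = refl
invST-coassoc G χ ρ (x ∷ ℓ) with χ x in χx | ρ x in ρx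
... | true  | _     rewrite χx = invST-coassoc G χ ρ ℓ
... | false | true  rewrite χx | ρx = begin
  A + (count χ-nbr (filterᵇ χ∨ρ ℓ) + B)
    ≡⟨ cong (λ n → A + (n + B)) (count-filterᵇ-weaker χ-nbr χ∨ρ χ-nbr⇒χ∨ρ ℓ) ⟩
  A + (count χ-nbr ℓ + B)
    ≡⟨ +-CS.x∙yz≈y∙xz A (count χ-nbr ℓ) B ⟩
  count χ-nbr ℓ + (A + B)
    ≡⟨ cong (count χ-nbr ℓ +_) (invST-coassoc G χ ρ ℓ) ⟩
  count χ-nbr ℓ + (C + D)
    ≡⟨ ℕ.+-assoc (count χ-nbr ℓ) C D ⟨
  (count χ-nbr ℓ + C) + D ∎
  where
  open ≡-Reasoning
  χ∨ρ χ-nbr : Decomp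
  χ∨ρ v = χ v ∨ ρ v
  χ-nbr y = χ y ∧ adj G x y
  A B C D : ℕ
  A = invST G χ∨ρ ℓ
  B = invST G χ (filterᵇ χ∨ρ ℓ)
  C = invST G χ ℓ
  D = invST G ρ (filterᵇ (not ∘ χ) ℓ)
  χ-nbr⇒χ∨ρ : ∀ y → χ-nbr y ≡ true → χ∨ρ y ≡ true
  χ-nbr⇒χ∨ρ y nbr with χ y
  ... | true  = refl
  ... | false with () ← nbr
... | false | false rewrite ρx = begin
  (count (λ y → χ∨ρ y ∧ adj G x y) ℓ + A) + B
    ≡⟨ cong (λ n → (n + A) + B) (count-∨-∧ χ ρ (adj G x) ℓ) ⟩
  ((M + N) + A) + B
    ≡⟨ ℕ.+-assoc (M + N) A B ⟩
  (M + N) + (A + B)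
    ≡⟨ cong ((M + N) +_) (invST-coassoc G χ ρ ℓ) ⟩
  (M + N) + (C + D)
    ≡⟨ +-CS.interchange M N C D ⟩
  (M + C) + (N + D) ∎
  where
  open ≡-Reasoning
  χ∨ρ : Decomp
  χ∨ρ v = χ v ∨ ρ v
  M N A B C D : ℕ
  M = count (λ y → χ y ∧ adj G x y) ℓ
  N = count (λ y → ρ y ∧ adj G x y) (filterᵇ (not ∘ χ) ℓ)
  A = invST G χ∨ρ ℓ
  B = invST G χ (filterᵇ χ∨ρ ℓ)
  C = invST G χ ℓ
  D = invST G ρ (filterᵇ (not ∘ χ) ℓ)

assign : ℕ → Bool → Decomp → Decomp
assign x b χ v = if v ≡ᵇ x then b else χ v

record Toggles (a : ℕ) (χ₁ χ₀ : Decomp) : Set where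
  field
    χ₁-at : χ₁ a ≡ true
    χ₀-at : χ₀ a ≡ false
    agree : ∀ v → v ≢ a → χ₁ v ≡ χ₀ v

  agree-on : ∀ {ℓ} → All (a ≢_) ℓ → All (λ v → χ₁ v ≡ χ₀ v) ℓ
  agree-on = All.map (λ a≢v → agree _ (a≢v ∘ sym))

assign-toggles : ∀ x χ → Toggles x (assign x true χ) (assign x false χ)
assign-toggles x χ = record
  { χ₁-at = cong (if_then true else χ x) (≡ᵇ-refl x)
  ; χ₀-at = cong (if_then false else χ x) (≡ᵇ-refl x)
  ; agree = λ v v≢x → trans (cong (if_then true else χ v) (≢⇒≡ᵇ-false v≢x))
                            (sym (cong (if_then false else χ v) (≢⇒≡ᵇ-false v≢x)))
  }

assign-pres-toggles : ∀ {a χ₁ χ₀} x b → x ≢ a → Toggles a χ₁ χ₀ →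
                      Toggles a (assign x b χ₁) (assign x b χ₀)
assign-pres-toggles {a} {χ₁} {χ₀} x b x≢a tog = record
  { χ₁-at = trans (cong (if_then b else χ₁ a) a≢x) (Toggles.χ₁-at tog)
  ; χ₀-at = trans (cong (if_then b else χ₀ a) a≢x) (Toggles.χ₀-at tog)
  ; agree = λ v v≢a → cong (if v ≡ᵇ x then b else_) (Toggles.agree tog v v≢a)
  }
  where
  a≢x : (a ≡ᵇ x) ≡ false
  a≢x = ≢⇒≡ᵇ-false (x≢a ∘ sym)

invST-singleton : ∀ G χ a → invST G χ [ a ] ≡ 0
invST-singleton G χ a with χ a
... | true  = refl
... | false = refl

module Toggled {a χ₁ χ₀} (tog : Toggles a χ₁ χ₀) {ℓ′ : List ℕ} (a∉ℓ′ : All (a ≢_) ℓ′) where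
  open Toggles tog

  S′ T′ : List ℕ
  S′ = filterᵇ χ₀ ℓ′
  T′ = filterᵇ (not ∘ χ₀) ℓ′

  filterᵇ-agree : ∀ (f : Bool → Bool) → filterᵇ (f ∘ χ₁) ℓ′ ≡ filterᵇ (f ∘ χ₀) ℓ′
  filterᵇ-agree f = filterᵇ-cong (All.map (cong f) (agree-on a∉ℓ′))

  invST-agree : ∀ H → invST H χ₁ ℓ′ ≡ invST H χ₀ ℓ′
  invST-agree H = invST-cong H (agree-on a∉ℓ′)

  S₁-head : filterᵇ χ₁ (a ∷ ℓ′) ≡ a ∷ S′
  S₁-head = trans (filterᵇ-accept χ₁ ℓ′ χ₁-at) (cong (a ∷_) (filterᵇ-agree (λ b → b)))

  S₀-head : filterᵇ χ₀ (a ∷ ℓ′) ≡ S′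
  S₀-head = filterᵇ-reject χ₀ ℓ′ χ₀-at

  T₁-head : filterᵇ (not ∘ χ₁) (a ∷ ℓ′) ≡ T′
  T₁-head = trans (filterᵇ-reject (not ∘ χ₁) ℓ′ (cong not χ₁-at)) (filterᵇ-agree not)

  T₀-head : filterᵇ (not ∘ χ₀) (a ∷ ℓ′) ≡ a ∷ T′
  T₀-head = filterᵇ-accept (not ∘ χ₀) ℓ′ (cong not χ₀-at)

  invST-head : ∀ H → invST H χ₀ (a ∷ ℓ′) ≡ count (adj H a) S′ + invST H χ₁ (a ∷ ℓ′)
  invST-head H rewrite χ₀-at | χ₁-at =
    cong₂ _+_ (sym (count-filterᵇ (adj H a) χ₀ ℓ′)) (sym (invST-agree H))

  S₁-last : filterᵇ χ₁ (ℓ′ ∷ʳ a) ≡ S′ ∷ʳ a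
  S₁-last = trans (filterᵇ-++ χ₁ ℓ′ [ a ])
                  (cong₂ _++_ (filterᵇ-agree (λ b → b)) (filterᵇ-accept χ₁ [] χ₁-at))

  S₀-last : filterᵇ χ₀ (ℓ′ ∷ʳ a) ≡ S′
  S₀-last = trans (filterᵇ-++ χ₀ ℓ′ [ a ])
                  (trans (cong (S′ ++_) (filterᵇ-reject χ₀ [] χ₀-at)) (List.++-identityʳ S′))

  T₁-last : filterᵇ (not ∘ χ₁) (ℓ′ ∷ʳ a) ≡ T′
  T₁-last = trans (filterᵇ-++ (not ∘ χ₁) ℓ′ [ a ])
                  (trans (cong₂ _++_ (filterᵇ-agree not) (filterᵇ-reject (not ∘ χ₁) [] (cong not χ₁-at)))
                         (List.++-identityʳ T′))

  T₀-last : filterᵇ (not ∘ χ₀) (ℓ′ ∷ʳ a) ≡ T′ ∷ʳ a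
  T₀-last = trans (filterᵇ-++ (not ∘ χ₀) ℓ′ [ a ])
                  (cong (T′ ++_) (filterᵇ-accept (not ∘ χ₀) [] (cong not χ₀-at)))

  invST-last₀ : ∀ H → invST H χ₀ (ℓ′ ∷ʳ a) ≡ invST H χ₀ ℓ′
  invST-last₀ H = begin
    invST H χ₀ (ℓ′ ∷ʳ a)
      ≡⟨ invST-++ H χ₀ ℓ′ [ a ] ⟩
    crossEdges H T′ (filterᵇ χ₀ [ a ]) + (invST H χ₀ ℓ′ + invST H χ₀ [ a ])
      ≡⟨ cong₂ _+_ (trans (cong (crossEdges H T′) (filterᵇ-reject χ₀ [] χ₀-at)) (crossEdges-[]ʳ H T′))
                   (cong (invST H χ₀ ℓ′ +_) (invST-singleton H χ₀ a)) ⟩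
    invST H χ₀ ℓ′ + 0
      ≡⟨ ℕ.+-identityʳ _ ⟩
    invST H χ₀ ℓ′ ∎
    where open ≡-Reasoning

  invST-last : ∀ H → invST H χ₁ (ℓ′ ∷ʳ a) ≡ count (adj H a) T′ + invST H χ₀ (ℓ′ ∷ʳ a)
  invST-last H = begin
    invST H χ₁ (ℓ′ ∷ʳ a)
      ≡⟨ invST-++ H χ₁ ℓ′ [ a ] ⟩
    crossEdges H (filterᵇ (not ∘ χ₁) ℓ′) (filterᵇ χ₁ [ a ]) + (invST H χ₁ ℓ′ + invST H χ₁ [ a ])
      ≡⟨ cong₂ _+_ (cong₂ (crossEdges H) (filterᵇ-agree not) (filterᵇ-accept χ₁ [] χ₁-at))
                   (cong₂ _+_ (invST-agree H) (invST-singleton H χ₁ a)) ⟩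
    crossEdges H T′ [ a ] + (invST H χ₀ ℓ′ + 0)
      ≡⟨ cong₂ _+_ (crossEdges-singletonʳ H a T′) (trans (ℕ.+-identityʳ _) (sym (invST-last₀ H))) ⟩
    count (adj H a) T′ + invST H χ₀ (ℓ′ ∷ʳ a) ∎
    where open ≡-Reasoning

module FreeModules {c e} (F : Field c e) where
  open Field F renaming (_+_ to _+ᴷ_; refl to ≈-refl; sym to ≈-sym; trans to ≈-trans)
  open OverField F
  import Algebra.Properties.CommutativeSemigroup +-commutativeSemigroup as +ᴷ-CS

  sumOver : {D : Set} → (D → Carrier) → List D → Carrier
  sumOver h = foldr (λ d acc → h d +ᴷ acc) 0#

  VecEq-singleton : ∀ {B : Set} (_≟_ : DecidableEquality B) {k k′ : Carrier} {u w : B} →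
                    k ≈ k′ → u ≡ w → VecEq _≟_ ((k , u) ∷ []) ((k′ , w) ∷ [])
  VecEq-singleton _≟_ {u = u} k≈k′ refl b with ⌊ b ≟ u ⌋
  ... | true  = +-congʳ k≈k′
  ... | false = ≈-refl

  coeff-singletons-cancel : ∀ {B : Set} (_≟_ : DecidableEquality B) b {k k′ : Carrier} {u w : B} →
    u ≡ w → k +ᴷ k′ ≈ 0# → coeff _≟_ b ((k , u) ∷ []) +ᴷ coeff _≟_ b ((k′ , w) ∷ []) ≈ 0#
  coeff-singletons-cancel _≟_ b {u = u} refl k+k′≈0 with ⌊ b ≟ u ⌋
  ... | true  = ≈-trans (+-cong (+-identityʳ _) (+-identityʳ _)) k+k′≈0
  ... | false = +-identityˡ 0#

  coeff-++ : ∀ {B : Set} (_≟_ : DecidableEquality B) b (xs ys : FM B) →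
             coeff _≟_ b (xs ++ ys) ≈ coeff _≟_ b xs +ᴷ coeff _≟_ b ys
  coeff-++ _≟_ b [] ys = ≈-sym (+-identityˡ _)
  coeff-++ _≟_ b (p ∷ xs) ys with ⌊ b ≟ proj₂ p ⌋
  ... | true  = ≈-trans (+-congˡ (coeff-++ _≟_ b xs ys)) (≈-sym (+-assoc _ _ _))
  ... | false = coeff-++ _≟_ b xs ys

  coeff-concat-map : ∀ {B D : Set} (_≟_ : DecidableEquality B) b (f : D → FM B) ds →
                     coeff _≟_ b (concat (map f ds)) ≈ sumOver (λ d → coeff _≟_ b (f d)) ds
  coeff-concat-map _≟_ b f [] = ≈-refl
  coeff-concat-map _≟_ b f (d ∷ ds) =
    ≈-trans (coeff-++ _≟_ b (f d) (concat (map f ds))) (+-congˡ (coeff-concat-map _≟_ b f ds))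

  sumOver-zero : ∀ {D : Set} (h : D → Carrier) → (∀ d → h d ≈ 0#) → ∀ ds → sumOver h ds ≈ 0#
  sumOver-zero h h≈0 [] = ≈-refl
  sumOver-zero h h≈0 (d ∷ ds) = ≈-trans (+-cong (h≈0 d) (sumOver-zero h h≈0 ds)) (+-identityˡ 0#)

  sumOver-assign : ∀ (h : Decomp → Carrier) x ds →
    sumOver h (concatMap (λ χ → assign x true χ ∷ assign x false χ ∷ []) ds) ≈
    sumOver (λ χ → h (assign x true χ) +ᴷ h (assign x false χ)) ds
  sumOver-assign h x [] = ≈-refl
  sumOver-assign h x (χ ∷ ds) = ≈-trans (+-congˡ (+-congˡ (sumOver-assign h x ds))) (≈-sym (+-assoc _ _ _))

  -- Phrased with arbitrary toggled pairs, not just `assign a`, because the assignments that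
  -- `decomps` performs for the other vertices preserve toggled pairs but not that form.
  sumOver-decomps-cancel : ∀ L → Unique L → ∀ {a} → a ∈ L → (h : Decomp → Carrier) →
    (∀ {χ₁ χ₀} → Toggles a χ₁ χ₀ → h χ₁ +ᴷ h χ₀ ≈ 0#) → sumOver h (decomps L) ≈ 0#
  sumOver-decomps-cancel (x ∷ xs) (_ ∷ _) (here refl) h cancel =
    ≈-trans (sumOver-assign h x (decomps xs))
            (sumOver-zero _ (λ χ → cancel (assign-toggles x χ)) (decomps xs))
  sumOver-decomps-cancel (x ∷ xs) (x∉xs ∷ unique) {a} (there a∈xs) h cancel =
    ≈-trans (sumOver-assign h x (decomps xs)) (sumOver-decomps-cancel xs unique a∈xs _ pairs-cancel)
    where
    x≢a : x ≢ a
    x≢a = All.lookup x∉xs a∈xs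
    pairs-cancel : ∀ {χ₁ χ₀} → Toggles a χ₁ χ₀ →
      (h (assign x true χ₁) +ᴷ h (assign x false χ₁)) +ᴷ (h (assign x true χ₀) +ᴷ h (assign x false χ₀))
        ≈ 0#
    pairs-cancel tog = ≈-trans (+ᴷ-CS.interchange _ _ _ _)
      (≈-trans (+-cong (cancel (assign-pres-toggles x true x≢a tog))
                       (cancel (assign-pres-toggles x false x≢a tog)))
               (+-identityˡ 0#))

module Weights {c e} (F : Field c e) (q t : Field.Carrier F) where
  open Field F renaming (_+_ to _+ᴷ_; refl to ≈-refl; sym to ≈-sym; trans to ≈-trans)
  open OverField F
  import Algebra.Properties.CommutativeSemigroup *-commutativeSemigroup as *-CS
  open import Algebra.Properties.Ring ring using (-1*x≈-x)
  open import Algebra.Solver.CommutativeMonoid *-commutativeMonoid using (solve; _⊜_; _⊕_) renaming (id to I)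
  open import Relation.Binary.Reasoning.Setoid setoid

  pow-+ : ∀ x m n → pow x (m + n) ≈ pow x m * pow x n
  pow-+ x zero    n = ≈-sym (*-identityˡ _)
  pow-+ x (suc m) n = ≈-trans (*-congˡ (pow-+ x m n)) (≈-sym (*-assoc _ _ _))

  qt : ℕ → ℕ → Carrier
  qt i j = pow q i * pow t j

  qt-+ : ∀ a a′ b b′ → qt (a + b) (a′ + b′) ≈ qt a a′ * qt b b′
  qt-+ a a′ b b′ = ≈-trans (*-cong (pow-+ q a b) (pow-+ t a′ b′))
                           (*-CS.interchange (pow q a) (pow q b) (pow t a′) (pow t b′))

  qt-≡ : ∀ {i i′ j j′} → i ≡ i′ → j ≡ j′ → qt i j ≈ qt i′ j′
  qt-≡ refl refl = ≈-refl

  qt-exchange : ∀ a a′ b b′ c c′ d d′ → a + b ≡ c + d → a′ + b′ ≡ c′ + d′ →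
                qt a a′ * qt b b′ ≈ qt c c′ * qt d d′
  qt-exchange a a′ b b′ c c′ d d′ eq eq′ = begin
    qt a a′ * qt b b′        ≈⟨ qt-+ a a′ b b′ ⟨
    qt (a + b) (a′ + b′)     ≈⟨ qt-≡ eq eq′ ⟩
    qt (c + d) (c′ + d′)     ≈⟨ qt-+ c c′ d d′ ⟩
    qt c c′ * qt d d′        ∎

  qt-split : ∀ {n n′} k k′ i i′ j j′ → n ≡ k + (i + j) → n′ ≡ k′ + (i′ + j′) →
             1# * qt n n′ ≈ qt k k′ * (qt i i′ * (qt j j′ * (1# * (1# * 1#))))
  qt-split {n} {n′} k k′ i i′ j j′ eq eq′ = begin
    1# * qt n n′
      ≈⟨ *-identityˡ _ ⟩
    qt n n′
      ≈⟨ qt-≡ eq eq′ ⟩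
    qt (k + (i + j)) (k′ + (i′ + j′))
      ≈⟨ qt-+ k k′ (i + j) (i′ + j′) ⟩
    qt k k′ * qt (i + j) (i′ + j′)
      ≈⟨ *-congˡ (qt-+ i i′ j j′) ⟩
    qt k k′ * (qt i i′ * qt j j′)
      ≈⟨ *-congˡ (*-congˡ (≈-trans (*-congˡ (≈-trans (*-identityˡ _) (*-identityˡ _))) (*-identityʳ _))) ⟨
    qt k k′ * (qt i i′ * (qt j j′ * (1# * (1# * 1#)))) ∎

  -- q^i t^i′ from Δ, then (-1)^k q^d t^d′ from s on k vertices with d and d′ edges, then 1 from μ.
  antipodeCoeff : ℕ → ℕ → ℕ → ℕ → ℕ → Carrier
  antipodeCoeff i i′ k d d′ = qt i i′ * ((pow (- 1#) k * qt d d′) * 1#)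

  antipodeCoeff-≡ : ∀ {i j i′ j′ k l d f d′ f′} → i ≡ j → i′ ≡ j′ → k ≡ l → d ≡ f → d′ ≡ f′ →
                    antipodeCoeff i i′ k d d′ ≈ antipodeCoeff j j′ l f f′
  antipodeCoeff-≡ refl refl refl refl refl = ≈-refl

  antipodeCoeff-toggle : ∀ n n′ i i′ k d d′ →
    antipodeCoeff i i′ (suc k) (n + d) (n′ + d′) +ᴷ antipodeCoeff (n + i) (n′ + i′) k d d′ ≈ 0#
  antipodeCoeff-toggle n n′ i i′ k d d′ = begin
    qt i i′ * ((- 1# * pow (- 1#) k * qt (n + d) (n′ + d′)) * 1#) +ᴷ
    qt (n + i) (n′ + i′) * ((pow (- 1#) k * qt d d′) * 1#)
      ≈⟨ +-cong (*-congˡ (*-congʳ (*-congˡ (qt-+ n n′ d d′)))) (*-congʳ (qt-+ n n′ i i′)) ⟩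
    qt i i′ * ((- 1# * pow (- 1#) k * (qt n n′ * qt d d′)) * 1#) +ᴷ
    (qt n n′ * qt i i′) * ((pow (- 1#) k * qt d d′) * 1#)
      ≈⟨ +-cong (solve 5 (λ s x m u y → x ⊕ (((s ⊕ m) ⊕ (u ⊕ y)) ⊕ I) ⊜ s ⊕ (((u ⊕ x) ⊕ m) ⊕ y))
                         ≈-refl (- 1#) (qt i i′) (pow (- 1#) k) (qt n n′) (qt d d′))
                (solve 4 (λ u x m y → (u ⊕ x) ⊕ ((m ⊕ y) ⊕ I) ⊜ ((u ⊕ x) ⊕ m) ⊕ y)
                         ≈-refl (qt n n′) (qt i i′) (pow (- 1#) k) (qt d d′)) ⟩
    - 1# * w +ᴷ w
      ≈⟨ +-congʳ (-1*x≈-x w) ⟩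
    - w +ᴷ w
      ≈⟨ -‿inverseˡ w ⟩
    0# ∎
    where
    w : Carrier
    w = qt n n′ * qt i i′ * pow (- 1#) k * qt d d′

module LinearOrderSpecies {c e} (F : Field c e) (q t : Field.Carrier F) where
  open Field F renaming (_+_ to _+ᴷ_; refl to ≈-refl; sym to ≈-sym; trans to ≈-trans)
  open OverField F
  open FreeModules F
  open Weights F q t

  _≟L²_ : DecidableEquality (List ℕ × List ℕ)
  _≟L²_ = ×.≡-dec _≟L_ _≟L_

  ΔL-counit-coefficient : ∀ {i j} → i ≡ 0 → j ≡ 0 → qt i j * (1# * 1#) ≈ 1#
  ΔL-counit-coefficient refl refl = ≈-trans (*-cong (*-identityˡ 1#) (*-identityˡ 1#)) (*-identityˡ 1#)

  ΔL-counitˡ : ∀ G ℓ → VecEq _≟L_ (bind (ΔL q t G (const false) ℓ) (λ p → εL (proj₁ p) ·ᶠ basisVec (proj₂ p)))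
                                  (basisVec ℓ)
  ΔL-counitˡ G ℓ = VecEq-singleton _≟L_
    (ΔL-counit-coefficient (invST-const-false G ℓ) (invST-const-false (complement G) ℓ)) (filterᵇ-true ℓ)

  ΔL-counitʳ : ∀ G ℓ → VecEq _≟L_ (bind (ΔL q t G (const true) ℓ) (λ p → εL (proj₂ p) ·ᶠ basisVec (proj₁ p)))
                                  (basisVec ℓ)
  ΔL-counitʳ G ℓ = VecEq-singleton _≟L_
    (ΔL-counit-coefficient (invST-const-true G ℓ) (invST-const-true (complement G) ℓ)) (filterᵇ-true ℓ)

  ΔL-coassoc : ∀ G χ ρ ℓ → let χ∨ρ = λ v → χ v ∨ ρ v in
    VecEq (×.≡-dec _≟L_ _≟L²_)
      (bind (ΔL q t G χ∨ρ ℓ) (λ p → mapᶠ (λ ab → (proj₁ ab , (proj₂ ab , proj₂ p)))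
                                         (ΔL q t (G ∣ χ∨ρ) χ (proj₁ p))))
      (bind (ΔL q t G χ ℓ) (λ p → mapᶠ (λ bc → (proj₁ p , bc)) (ΔL q t (G ∣ᶜ χ) ρ (proj₂ p))))
  ΔL-coassoc G χ ρ ℓ = VecEq-singleton (×.≡-dec _≟L_ _≟L²_)
    (qt-exchange (invST G χ∨ρ ℓ) (invST Ḡ χ∨ρ ℓ)
                 (invST (G ∣ χ∨ρ) χ ℓ∨) (invST (complement (G ∣ χ∨ρ)) χ ℓ∨)
                 (invST G χ ℓ) (invST Ḡ χ ℓ)
                 (invST (G ∣ᶜ χ) ρ ℓ¬χ) (invST (complement (G ∣ᶜ χ)) ρ ℓ¬χ)
                 (inversions G refl refl) (inversions Ḡ refl refl))
    (cong₂ _,_ (filterᵇ-filterᵇ-≗ χ χ∨ρ χ (λ v → absorb (χ v) (ρ v)) ℓ)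
      (cong₂ _,_ (trans (filterᵇ-filterᵇ-≗ (not ∘ χ) χ∨ρ _ (λ v → middle (χ v) (ρ v)) ℓ)
                        (sym (filterᵇ-filterᵇ ρ (not ∘ χ) ℓ)))
                 (sym (filterᵇ-filterᵇ-≗ (not ∘ ρ) (not ∘ χ) (not ∘ χ∨ρ) (λ v → neither (χ v) (ρ v)) ℓ))))
    where
    χ∨ρ : Decomp
    χ∨ρ v = χ v ∨ ρ v
    Ḡ : Graph
    Ḡ = complement G
    ℓ∨ ℓ¬χ : List ℕ
    ℓ∨ = filterᵇ χ∨ρ ℓ
    ℓ¬χ = filterᵇ (not ∘ χ) ℓ
    inversions : ∀ H {H₁ H₂} → adj H₁ ≡ adj H → adj H₂ ≡ adj H →
      invST H χ∨ρ ℓ + invST H₁ χ ℓ∨ ≡ invST H χ ℓ + invST H₂ ρ ℓ¬χ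
    inversions H eq₁ eq₂ =
      trans (cong (invST H χ∨ρ ℓ +_) (invST-adj eq₁ χ ℓ∨))
        (trans (invST-coassoc H χ ρ ℓ) (cong (invST H χ ℓ +_) (sym (invST-adj eq₂ ρ ℓ¬χ))))
    absorb : ∀ c r → (c ∨ r) ∧ c ≡ c
    absorb true  r     = refl
    absorb false true  = refl
    absorb false false = refl
    middle : ∀ c r → (c ∨ r) ∧ not c ≡ not c ∧ r
    middle true  r     = refl
    middle false true  = refl
    middle false false = refl
    neither : ∀ c r → not c ∧ not r ≡ not (c ∨ r)
    neither true  r = refl
    neither false r = refl

  μL-ΔL-compat : ∀ G χ χ′ x y → LinOrd (G ∣ χ) x → LinOrd (G ∣ᶜ χ) y →
    let X = V ((G ∣ χ) ∣ᶜ χ′) ; Y = V ((G ∣ᶜ χ) ∣ χ′) in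
    VecEq _≟L²_ (bind (μL G χ x y) (ΔL q t G χ′))
      (qt (crossEdges G X Y) (crossEdges (complement G) X Y)
        ·ᶠ bind (ΔL q t (G ∣ χ) χ′ x) (λ ab → bind (ΔL q t (G ∣ᶜ χ) χ′ y) (λ cd →
             μL (G ∣ χ′) χ (proj₁ ab) (proj₁ cd) ⊗ᶠ μL (G ∣ᶜ χ′) χ (proj₂ ab) (proj₂ cd))))
  μL-ΔL-compat G χ χ′ x y x↭ y↭ = VecEq-singleton _≟L²_
    (qt-split (crossEdges G X Y) (crossEdges Ḡ X Y)
              (invST (G ∣ χ) χ′ x) (invST (complement (G ∣ χ)) χ′ x)
              (invST (G ∣ᶜ χ) χ′ y) (invST (complement (G ∣ᶜ χ)) χ′ y)
              (inversions G refl refl) (inversions Ḡ refl refl))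
    (cong₂ _,_ (filterᵇ-++ χ′ x y) (filterᵇ-++ (not ∘ χ′) x y))
    where
    Ḡ : Graph
    Ḡ = complement G
    X Y : List ℕ
    X = V ((G ∣ χ) ∣ᶜ χ′)
    Y = V ((G ∣ᶜ χ) ∣ χ′)
    inversions : ∀ H {Hx Hy} → adj Hx ≡ adj H → adj Hy ≡ adj H →
      invST H χ′ (x ++ y) ≡ crossEdges H X Y + (invST Hx χ′ x + invST Hy χ′ y)
    inversions H eqx eqy = trans (invST-++ H χ′ x y)
      (cong₂ _+_ (trans (crossEdges-↭ˡ H (filterᵇ χ′ y) (filterᵇ-↭ (not ∘ χ′) x↭))
                        (crossEdges-↭ʳ H X (filterᵇ-↭ χ′ y↭)))
                 (sym (cong₂ _+_ (invST-adj eqx χ′ x) (invST-adj eqy χ′ y))))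

  ΔL-nat : ∀ G H σ → IsIso G H σ → ∀ χ χ′ → (∀ v → v ∈ V G → χ′ (σ v) ≡ χ v) → ∀ ℓ → LinOrd G ℓ →
           VecEq _≟L²_ (ΔL q t H χ′ (map σ ℓ)) (mapᶠ (λ p → (map σ (proj₁ p) , map σ (proj₂ p))) (ΔL q t G χ ℓ))
  ΔL-nat G H σ iso χ χ′ χ-pres ℓ ℓ↭ = VecEq-singleton _≟L²_
    (qt-≡ (invST-map G H σ iso χ-pres ℓ⊆V)
          (invST-map (complement G) (complement H) σ (complement-iso G H σ iso) χ-pres ℓ⊆V))
    (cong₂ _,_ (trans (filterᵇ-map χ′ σ ℓ) (cong (map σ) (filterᵇ-cong χ-pres-ℓ)))
               (trans (filterᵇ-map (not ∘ χ′) σ ℓ) (cong (map σ) (filterᵇ-cong (All.map (cong not) χ-pres-ℓ)))))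
    where
    ℓ⊆V : ℓ ⊆ V G
    ℓ⊆V = ↭.∈-resp-↭ ℓ↭
    χ-pres-ℓ : All (λ v → χ′ (σ v) ≡ χ v) ℓ
    χ-pres-ℓ = All.tabulate (λ v∈ → χ-pres _ (ℓ⊆V v∈))

  sL-nat : ∀ G H σ → IsIso G H σ → ∀ ℓ → VecEq _≟L_ (sL q t H (map σ ℓ)) (mapᶠ (map σ) (sL q t G ℓ))
  sL-nat G H σ iso@(σV↭V , _) ℓ = VecEq-singleton _≟L_
    (*-cong (reflexive (cong (pow (- 1#)) (trans (sym (↭.↭-length σV↭V)) (List.length-map σ (V G)))))
            (qt-≡ (numEdges-iso G H σ iso) (numEdges-iso (complement G) (complement H) σ (complement-iso G H σ iso))))
    (sym (List.reverse-map σ ℓ))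

  antipodeˡ-term antipodeʳ-term : Graph → List ℕ → Decomp → FM (List ℕ)
  antipodeˡ-term G ℓ χ = bind (ΔL q t G χ ℓ) (λ p → bind (sL q t (G ∣ χ) (proj₁ p)) (λ a → μL G χ a (proj₂ p)))
  antipodeʳ-term G ℓ χ = bind (ΔL q t G χ ℓ) (λ p → bind (sL q t (G ∣ᶜ χ) (proj₂ p)) (λ b → μL G χ (proj₁ p) b))

  -- P₊ is the side receiving the antipode when it contains a, P₋ the same side once a has moved.
  toggle-coefficients-cancel : ∀ G a {P P₊ P₋ : List ℕ} {i₊ i₊′ i₋ i₋′} → P₊ ↭ a ∷ P → P₋ ↭ P →
    i₋ ≡ count (adj G a) P + i₊ → i₋′ ≡ count (adj (complement G) a) P + i₊′ →
    antipodeCoeff i₊ i₊′ (length P₊) (edgesOf (adj G) P₊) (edgesOf (adj (complement G)) P₊) +ᴷ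
    antipodeCoeff i₋ i₋′ (length P₋) (edgesOf (adj G) P₋) (edgesOf (adj (complement G)) P₋) ≈ 0#
  toggle-coefficients-cancel G a {P} {i₊ = i₊} {i₊′} P₊↭ P₋↭ inv inv′ = ≈-trans
    (+-cong (antipodeCoeff-≡ {i₊} {i₊} {i₊′} {i₊′} refl refl
                             (↭.↭-length P₊↭) (edgesOf-↭ G P₊↭) (edgesOf-↭ (complement G) P₊↭))
            (antipodeCoeff-≡ inv inv′ (↭.↭-length P₋↭) (edgesOf-↭ G P₋↭) (edgesOf-↭ (complement G) P₋↭)))
    (antipodeCoeff-toggle (count (adj G a) P) (count (adj (complement G) a) P) i₊ i₊′
                          (length P) (edgesOf (adj G) P) (edgesOf (adj (complement G)) P))

  restrict-↭ : ∀ G {ℓ} → LinOrd G ℓ → ∀ p {P} → filterᵇ p ℓ ≡ P → filterᵇ p (V G) ↭ P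
  restrict-↭ G ℓ↭ p eq = ↭-trans (filterᵇ-↭ p (↭-sym ℓ↭)) (↭-reflexive eq)

  antipodeˡ-toggle : ∀ G a ℓ′ → LinOrd G (a ∷ ℓ′) → ∀ {χ₁ χ₀} → Toggles a χ₁ χ₀ → ∀ b →
    coeff _≟L_ b (antipodeˡ-term G (a ∷ ℓ′) χ₁) +ᴷ coeff _≟L_ b (antipodeˡ-term G (a ∷ ℓ′) χ₀) ≈ 0#
  antipodeˡ-toggle G a ℓ′ ℓ↭ {χ₁} {χ₀} tog b = coeff-singletons-cancel _≟L_ b word
    (toggle-coefficients-cancel G a (restrict-↭ G ℓ↭ χ₁ S₁-head) (restrict-↭ G ℓ↭ χ₀ S₀-head)
                                (invST-head G) (invST-head (complement G)))
    where
    open Toggled tog (AllPairs.head (Unique-resp-↭ (↭-sym ℓ↭) (V-unique G)))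
    word : reverse (filterᵇ χ₁ (a ∷ ℓ′)) ++ filterᵇ (not ∘ χ₁) (a ∷ ℓ′) ≡
           reverse (filterᵇ χ₀ (a ∷ ℓ′)) ++ filterᵇ (not ∘ χ₀) (a ∷ ℓ′)
    word = begin
      reverse (filterᵇ χ₁ (a ∷ ℓ′)) ++ filterᵇ (not ∘ χ₁) (a ∷ ℓ′)
        ≡⟨ cong₂ (λ s t → reverse s ++ t) S₁-head T₁-head ⟩
      reverse (a ∷ S′) ++ T′
        ≡⟨ cong (_++ T′) (List.unfold-reverse a S′) ⟩
      (reverse S′ ∷ʳ a) ++ T′
        ≡⟨ List.++-assoc (reverse S′) [ a ] T′ ⟩
      reverse S′ ++ a ∷ T′
        ≡⟨ cong₂ (λ s t → reverse s ++ t) S₀-head T₀-head ⟨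
      reverse (filterᵇ χ₀ (a ∷ ℓ′)) ++ filterᵇ (not ∘ χ₀) (a ∷ ℓ′) ∎
      where open ≡-Reasoning

  antipodeʳ-toggle : ∀ G a ℓ′ → LinOrd G (ℓ′ ∷ʳ a) → ∀ {χ₁ χ₀} → Toggles a χ₁ χ₀ → ∀ b →
    coeff _≟L_ b (antipodeʳ-term G (ℓ′ ∷ʳ a) χ₁) +ᴷ coeff _≟L_ b (antipodeʳ-term G (ℓ′ ∷ʳ a) χ₀) ≈ 0#
  antipodeʳ-toggle G a ℓ′ ℓ↭ {χ₁} {χ₀} tog b = coeff-singletons-cancel _≟L_ b word
    (≈-trans (+-comm _ _)
      (toggle-coefficients-cancel G a (↭-trans (restrict-↭ G ℓ↭ (not ∘ χ₀) T₀-last) (↭.++-comm T′ [ a ]))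
                                  (restrict-↭ G ℓ↭ (not ∘ χ₁) T₁-last)
                                  (invST-last G) (invST-last (complement G))))
    where
    a∉ℓ′ : All (a ≢_) ℓ′
    a∉ℓ′ = AllPairs.head (Unique-resp-↭ (↭-trans (↭-sym ℓ↭) (↭.++-comm ℓ′ [ a ])) (V-unique G))
    open Toggled tog a∉ℓ′
    word : filterᵇ χ₁ (ℓ′ ∷ʳ a) ++ reverse (filterᵇ (not ∘ χ₁) (ℓ′ ∷ʳ a)) ≡
           filterᵇ χ₀ (ℓ′ ∷ʳ a) ++ reverse (filterᵇ (not ∘ χ₀) (ℓ′ ∷ʳ a))
    word = begin
      filterᵇ χ₁ (ℓ′ ∷ʳ a) ++ reverse (filterᵇ (not ∘ χ₁) (ℓ′ ∷ʳ a))
        ≡⟨ cong₂ (λ s t → s ++ reverse t) S₁-last T₁-last ⟩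
      (S′ ∷ʳ a) ++ reverse T′
        ≡⟨ List.++-assoc S′ [ a ] (reverse T′) ⟩
      S′ ++ a ∷ reverse T′
        ≡⟨ cong (S′ ++_) (List.reverse-++ T′ [ a ]) ⟨
      S′ ++ reverse (T′ ∷ʳ a)
        ≡⟨ cong₂ (λ s t → s ++ reverse t) S₀-last T₀-last ⟨
      filterᵇ χ₀ (ℓ′ ∷ʳ a) ++ reverse (filterᵇ (not ∘ χ₀) (ℓ′ ∷ʳ a)) ∎
      where open ≡-Reasoning

  antipodeˡ-sum : ∀ G ℓ → LinOrd G ℓ → V G ≢ [] →
                  VecEq _≟L_ (sumᶠ (map (antipodeˡ-term G ℓ) (decomps (V G)))) zeroᶠ
  antipodeˡ-sum G [] ℓ↭ V≢[] b = ⊥-elim (V≢[] (↭.↭-empty-inv (↭-sym ℓ↭)))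
  antipodeˡ-sum G (a ∷ ℓ′) ℓ↭ _ b =
    ≈-trans (coeff-concat-map _≟L_ b (antipodeˡ-term G (a ∷ ℓ′)) (decomps (V G)))
            (sumOver-decomps-cancel (V G) (V-unique G) (↭.∈-resp-↭ ℓ↭ (here refl)) _
                                    (λ tog → antipodeˡ-toggle G a ℓ′ ℓ↭ tog b))

  antipodeʳ-sum : ∀ G ℓ → LinOrd G ℓ → V G ≢ [] →
                  VecEq _≟L_ (sumᶠ (map (antipodeʳ-term G ℓ) (decomps (V G)))) zeroᶠ
  antipodeʳ-sum G ℓ ℓ↭ V≢[] b with reverseView ℓ
  ... | []           = ⊥-elim (V≢[] (↭.↭-empty-inv (↭-sym ℓ↭)))
  ... | ℓ′ ∶ _ ∶ʳ a  =
    ≈-trans (coeff-concat-map _≟L_ b (antipodeʳ-term G (ℓ′ ∷ʳ a)) (decomps (V G)))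
            (sumOver-decomps-cancel (V G) (V-unique G) (↭.∈-resp-↭ ℓ↭ (∈-++⁺ʳ ℓ′ (here refl))) _
                                    (λ tog → antipodeʳ-toggle G a ℓ′ ℓ↭ tog b))

  antipodeCoeff-empty : antipodeCoeff 0 0 0 0 0 ≈ 1# * 1#
  antipodeCoeff-empty = ≈-trans (*-congˡ (≈-trans (*-identityʳ _) (≈-trans (*-identityˡ _) (*-identityˡ 1#))))
                                (*-identityʳ _)

  antipode∅ˡ-sum : ∀ G ℓ → LinOrd G ℓ → V G ≡ [] →
                   VecEq _≟L_ (sumᶠ (map (antipodeˡ-term G ℓ) (decomps (V G)))) (εL ℓ ·ᶠ ηL)
  antipode∅ˡ-sum G (_ ∷ _) ℓ↭ V≡[] with () ← ↭.↭-empty-inv (subst (_ ↭_) V≡[] ℓ↭)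
  antipode∅ˡ-sum G [] ℓ↭ V≡[] rewrite V≡[] = VecEq-singleton _≟L_ antipodeCoeff-empty refl

  antipode∅ʳ-sum : ∀ G ℓ → LinOrd G ℓ → V G ≡ [] →
                   VecEq _≟L_ (sumᶠ (map (antipodeʳ-term G ℓ) (decomps (V G)))) (εL ℓ ·ᶠ ηL)
  antipode∅ʳ-sum G (_ ∷ _) ℓ↭ V≡[] with () ← ↭.↭-empty-inv (subst (_ ↭_) V≡[] ℓ↭)
  antipode∅ʳ-sum G [] ℓ↭ V≡[] rewrite V≡[] = VecEq-singleton _≟L_ antipodeCoeff-empty refl

  isQTHopfMonoid : IsQTHopfMonoid q t (List ℕ) _≟L_ LinOrd actL μL (ΔL q t) (sL q t) ηL εL
  isQTHopfMonoid = record
    { act-basis  = λ G H σ iso ℓ ℓ↭ → ↭-trans (↭.map⁺ σ ℓ↭) (proj₁ iso)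
    ; act-id     = λ G ℓ _ → List.map-id ℓ
    ; act-∘      = λ G σ τ ℓ _ → List.map-∘ ℓ
    ; μ-basis    = λ G χ x y x↭ y↭ → ↭-trans (↭.++⁺ x↭ y↭) (filterᵇ-partition χ (V G)) ∷ []
    ; Δ-basis    = λ G χ ℓ ℓ↭ → (filterᵇ-↭ χ ℓ↭ , filterᵇ-↭ (not ∘ χ) ℓ↭) ∷ []
    ; s-basis    = λ G ℓ ℓ↭ → ↭-trans (↭.↭-reverse ℓ) ℓ↭ ∷ []
    ; η-basis    = λ G V≡[] → ↭-reflexive (sym V≡[]) ∷ []
    ; μ-nat      = λ G H σ iso χ χ′ _ x y _ _ → VecEq-singleton _≟L_ ≈-refl (sym (List.map-++ σ x y))
    ; Δ-nat      = λ G H σ iso χ χ′ χ-pres ℓ ℓ↭ → ΔL-nat G H σ iso χ χ′ χ-pres ℓ ℓ↭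
    ; s-nat      = λ G H σ iso ℓ _ → sL-nat G H σ iso ℓ
    ; η-nat      = λ _ _ _ _ _ → VecEq-singleton _≟L_ ≈-refl refl
    ; ε-nat      = λ _ _ _ _ _ _ _ → ≈-refl
    ; μ-assoc    = λ G χ ρ x y z _ _ _ → VecEq-singleton _≟L_ ≈-refl (List.++-assoc x y z)
    ; μ-unitˡ    = λ G ℓ _ → VecEq-singleton _≟L_ (*-identityˡ 1#) refl
    ; μ-unitʳ    = λ G ℓ _ → VecEq-singleton _≟L_ (*-identityˡ 1#) (List.++-identityʳ ℓ)
    ; Δ-coassoc  = λ G χ ρ ℓ _ → ΔL-coassoc G χ ρ ℓ
    ; Δ-counitˡ  = λ G ℓ _ → ΔL-counitˡ G ℓ
    ; Δ-counitʳ  = λ G ℓ _ → ΔL-counitʳ G ℓ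
    ; ε-η        = ≈-trans (+-identityʳ _) (*-identityˡ 1#)
    ; Δ-η        = λ _ _ _ → VecEq-singleton _≟L²_ ≈-refl refl
    ; ε-μ        = λ _ _ _ _ _ _ _ → +-identityʳ _
    ; compat     = μL-ΔL-compat
    ; antipodeˡ  = antipodeˡ-sum
    ; antipodeʳ  = antipodeʳ-sum
    ; antipode∅ˡ = antipode∅ˡ-sum
    ; antipode∅ʳ = antipode∅ʳ-sum
    }

mainTheorem2 : ∀ {c ℓ} (F : Field c ℓ) (q t : Field.Carrier F) →
    OverField.IsQTHopfMonoid F q t (List ℕ) (OverField._≟L_ F)
      (OverField.LinOrd F) (OverField.actL F) (OverField.μL F)
      (OverField.ΔL F q t) (OverField.sL F q t) (OverField.ηL F) (OverField.εL F)
mainTheorem2 F q t = LinearOrderSpecies.isQTHopfMonoid F q t
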